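{- Let $R,S:X\leftrightarrow\mathcal{P}Y$ be outer univalent multirelations. Then $R\sqsubseteq_\uparrow S\Leftrightarrow R\Cup S=S$ and $R\sqsubseteq_\downarrow S\Leftrightarrow R\Cap S=R$.
   Context: A multirelation is a relation $R\subseteq X\times\mathcal{P}Y$; it is outer univalent if each $a\in X$ is related to at most one set. Inner union $R\Cup S=\{(a,A\cup B)\mid (a,A)\in R\wedge (a,B)\in S\}$, inner intersection $R\Cap S=\{(a,A\cap B)\mid (a,A)\in R\wedge (a,B)\in S\}$. Inner closures: $\uparrow R=\{(a,A)\mid\exists B.\,(a,B)\in R\wedge B\subseteq A\}$, $\downarrow R=\{(a,A)\mid\exists B.\,(a,B)\in R\wedge A\subseteq B\}$. Preorders: $R\sqsubseteq_\uparrow S\Leftrightarrow S\subseteq\uparrow R$; $R\sqsubseteq_\downarrow S\Leftrightarrow R\subseteq\downarrow S$. -}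

module Defs where

open import Level using (0ℓ) renaming (suc to lsuc)
open import Data.Product using (Σ; ∃; ∃-syntax; _×_; _,_)
open import Relation.Unary using (Pred; _⊆_; _∪_; _∩_; _≐_)

𝒫 : Set → Set₁
𝒫 Y = Pred Y 0ℓ

MRel : Set → Set → Set₂
MRel X Y = X → 𝒫 Y → Set₁

-- Since subsets are predicates, a multirelation must not distinguish
-- extensionally equal subsets (this is what "R ⊆ X × 𝒫Y" means).
Extensional : {X Y : Set} → MRel X Y → Set₁
Extensional {X} {Y} R = ∀ (a : X) (A B : 𝒫 Y) → A ≐ B → R a A → R a B

OuterUnivalent : {X Y : Set} → MRel X Y → Set₁
OuterUnivalent {X} {Y} R = ∀ (a : X) (A B : 𝒫 Y) → R a A → R a B → A ≐ B

_⊑_ : {X Y : Set} → MRel X Y → MRel X Y → Set₁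
_⊑_ {X} {Y} R S = ∀ (a : X) (A : 𝒫 Y) → R a A → S a A

_≋_ : {X Y : Set} → MRel X Y → MRel X Y → Set₁
R ≋ S = (R ⊑ S) × (S ⊑ R)

_⋓_ : {X Y : Set} → MRel X Y → MRel X Y → MRel X Y
(R ⋓ S) a C = ∃[ A ] ∃[ B ] (R a A × S a B × (C ≐ (A ∪ B)))

_⋒_ : {X Y : Set} → MRel X Y → MRel X Y → MRel X Y
(R ⋒ S) a C = ∃[ A ] ∃[ B ] (R a A × S a B × (C ≐ (A ∩ B)))

↑ : {X Y : Set} → MRel X Y → MRel X Y
↑ R a A = ∃[ B ] (R a B × (B ⊆ A))

↓ : {X Y : Set} → MRel X Y → MRel X Y
↓ R a A = ∃[ B ] (R a B × (A ⊆ B))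

_⊑↑_ : {X Y : Set} → MRel X Y → MRel X Y → Set₁
R ⊑↑ S = S ⊑ ↑ R

_⊑↓_ : {X Y : Set} → MRel X Y → MRel X Y → Set₁
R ⊑↓ S = R ⊑ ↓ S

-- Without univalence, R ⊑↑ S is already equivalent to S ⊑ R ⋓ S, and dually
-- R ⊑↓ S to R ⊑ R ⋒ S. The remaining inclusions are where outer univalence
-- enters: if R relates a only to A, then R ⊑↑ S places A below every S-image
-- B of a, so A ∪ B ≐ B; dually, if S relates a only to B, then R ⊑↓ S places
-- every R-image A of a below B, so A ∩ B ≐ A.
module Submission where

open import Defs
open import Data.Product using (_×_; _,_; proj₁; proj₂)
open import Data.Sum using (inj₁; inj₂; [_,_])
open import Function using (id)
open import Function.Bundles using (_⇔_; mk⇔; Equivalence)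
open import Relation.Unary using (_⊆_; _∪_; _∩_; _≐_)
open import Relation.Unary.Properties using (≐-sym; ≐-trans)

private
  variable
    X Y : Set
    R S : MRel X Y

⊆⇒∪≐ : {A B : 𝒫 Y} → A ⊆ B → (A ∪ B) ≐ B
⊆⇒∪≐ A⊆B = [ A⊆B , id ] , inj₂

⊆⇒∩≐ : {A B : 𝒫 Y} → A ⊆ B → (A ∩ B) ≐ A
⊆⇒∩≐ A⊆B = proj₁ , λ x∈A → x∈A , A⊆B x∈A

⊑↑⇔⊑⋓ : (R ⊑↑ S) ⇔ (S ⊑ (R ⋓ S))
⊑↑⇔⊑⋓ {R = R} {S = S} = mk⇔ to from
  where
  to : R ⊑↑ S → S ⊑ (R ⋓ S)
  to R⊑↑S a B sB with R⊑↑S a B sB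
  ... | A , rA , A⊆B = A , B , rA , sB , ≐-sym (⊆⇒∪≐ A⊆B)

  from : S ⊑ (R ⋓ S) → R ⊑↑ S
  from S⊑R⋓S a B sB with S⊑R⋓S a B sB
  ... | A , _ , rA , _ , B≐A∪B′ = A , rA , λ x∈A → proj₂ B≐A∪B′ (inj₁ x∈A)

⊑↓⇔⊑⋒ : (R ⊑↓ S) ⇔ (R ⊑ (R ⋒ S))
⊑↓⇔⊑⋒ {R = R} {S = S} = mk⇔ to from
  where
  to : R ⊑↓ S → R ⊑ (R ⋒ S)
  to R⊑↓S a A rA with R⊑↓S a A rA
  ... | B , sB , A⊆B = A , B , rA , sB , ≐-sym (⊆⇒∩≐ A⊆B)

  from : R ⊑ (R ⋒ S) → R ⊑↓ S
  from R⊑R⋒S a A rA with R⊑R⋒S a A rA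
  ... | _ , B , _ , sB , A≐A′∩B = B , sB , λ x∈A → proj₂ (proj₁ A≐A′∩B x∈A)

⊑↑⇒⋓⊑ : Extensional S → OuterUnivalent R → R ⊑↑ S → (R ⋓ S) ⊑ S
⊑↑⇒⋓⊑ extS univR R⊑↑S a C (A , B , rA , sB , C≐A∪B) with R⊑↑S a B sB
... | A′ , rA′ , A′⊆B = extS a B C (≐-sym C≐B) sB
  where
  A⊆B : A ⊆ B
  A⊆B x∈A = A′⊆B (proj₁ (univR a A A′ rA rA′) x∈A)

  C≐B : C ≐ B
  C≐B = ≐-trans C≐A∪B (⊆⇒∪≐ A⊆B)

⊑↓⇒⋒⊑ : Extensional R → OuterUnivalent S → R ⊑↓ S → (R ⋒ S) ⊑ R
⊑↓⇒⋒⊑ extR univS R⊑↓S a C (A , B , rA , sB , C≐A∩B) with R⊑↓S a A rA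
... | B′ , sB′ , A⊆B′ = extR a A C (≐-sym C≐A) rA
  where
  A⊆B : A ⊆ B
  A⊆B x∈A = proj₁ (univS a B′ B sB′ sB) (A⊆B′ x∈A)

  C≐A : C ≐ A
  C≐A = ≐-trans C≐A∩B (⊆⇒∩≐ A⊆B)

lemma5p9 : {X Y : Set} (R S : MRel X Y) →
    Extensional R → Extensional S →
    OuterUnivalent R → OuterUnivalent S →
    ((R ⊑↑ S) ⇔ ((R ⋓ S) ≋ S)) × ((R ⊑↓ S) ⇔ ((R ⋒ S) ≋ R))
lemma5p9 R S extR extS univR univS =
  mk⇔ (λ R⊑↑S → ⊑↑⇒⋓⊑ extS univR R⊑↑S , Equivalence.to ⊑↑⇔⊑⋓ R⊑↑S)
      (λ (_ , S⊑R⋓S) → Equivalence.from ⊑↑⇔⊑⋓ S⊑R⋓S)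
  ,
  mk⇔ (λ R⊑↓S → ⊑↓⇒⋒⊑ extR univS R⊑↓S , Equivalence.to ⊑↓⇔⊑⋒ R⊑↓S)
      (λ (_ , R⊑R⋒S) → Equivalence.from ⊑↓⇔⊑⋒ R⊑R⋒S)
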